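{- Let $p$ be a prime with $p\equiv 3 \pmod 4$ and $p>3$, and let $\chi_{4p}$ be the quadratic Dirichlet character (Kronecker symbol) of conductor $4p$ associated with $\mathbb{Q}(\sqrt{p})$. Then \[ \prod_{\substack{a\in[1,4p]\\ \chi_{4p}(a)=1}} a \equiv \prod_{\substack{b\in[1,4p]\\ \chi_{4p}(b)=-1}} b \equiv -1 \pmod p. \] -}

module Defs where

open import Data.Nat using (ℕ; zero; suc; _+_; _*_; _%_; _≡ᵇ_)
open import Data.Bool using (Bool; true; false; if_then_else_)
open import Data.Integer using (ℤ; +_; -[1+_]; _*_)
open import Data.List using (List; upTo; map)
open import Data.Bool.ListAction using (any)

isSquareMod : ℕ → ℕ → Bool
isSquareMod zero    a = false
isSquareMod (suc q) a =
  any (λ x → ((x Data.Nat.* x) % suc q) ≡ᵇ (a % suc q)) (upTo (suc q))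

legendre : ℕ → ℕ → ℤ
legendre zero    a = + 0
legendre (suc q) a with a % suc q ≡ᵇ 0
... | true  = + 0
... | false = if isSquareMod (suc q) a then + 1 else -[1+ 0 ]

chi-4 : ℕ → ℤ
chi-4 a with a % 4
... | 1 = + 1
... | 3 = -[1+ 0 ]
... | _ = + 0

-- For a prime p ≡ 3 (mod 4), the Kronecker symbol (4p / a) attached to Q(√p)
-- equals χ_{-4}(a) · (a / p)  (zero on even a).
chi4p : ℕ → ℕ → ℤ
chi4p p a = chi-4 a Data.Integer.* legendre p a

oneTo : ℕ → List ℕ
oneTo n = map suc (upTo n)

{-# OPTIONS --safe #-}
module Submission where

-- Split [1, 4p] into the p blocks {x, x + p, x + 2p, x + 3p} with 1 ≤ x ≤ p.  For x < p the
-- Legendre symbol is constant on the block, and since p ≡ 3 (mod 4) the block meets every residue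
-- class mod 4; so χ₄ₚ takes each of the values ±1 at exactly one element of the block, and that
-- element is ≡ x (mod p).  On the block of multiples of p, χ₄ₚ vanishes.  Hence both products are
-- ≡ (p - 1)! (mod p), which is ≡ -1 by Wilson's theorem: every element of [2, p - 2] pairs off with
-- its inverse mod p, which differs from it because ±1 are the only square roots of 1.

open import Defs

open import Data.Nat as ℕ
  using ( ℕ; zero; suc; _+_; _*_; _∸_; _^_; _!; _%_; _/_; _≤_; _<_; _>_; s≤s; z<s; s<s
        ; NonZero; _≡ᵇ_; nonTrivial⇒n>1 )
open import Relation.Binary.PropositionalEquality as ≡
  using (_≡_; _≢_; refl; sym; trans; cong; cong₂; subst; module ≡-Reasoning)
open import Algebra.Properties.CommutativeSemigroup using (interchange)
open import Data.Bool using (Bool; true; false; if_then_else_; T)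
open import Data.Bool.ListAction using (any)
open import Data.Integer as ℤ using (ℤ; +_; -[1+_])
open import Data.Integer.Properties as ℤ using (_≟_)
open import Data.List using (List; []; _∷_; _++_; length; map; filter; applyUpTo; upTo)
open import Data.List.Membership.Propositional using (_∈_; _∉_)
open import Data.List.Membership.Propositional.Properties using (∈-∃++; ∈-applyUpTo⁺; ∈-applyUpTo⁻; ∈-upTo⁺)
open import Data.List.Properties using (map-upTo; map-applyUpTo; length-applyUpTo)
open import Data.List.Relation.Binary.Permutation.Propositional using (_↭_; prep; ↭-sym; ↭⇒↭ₛ)
open import Data.List.Relation.Binary.Permutation.Propositional.Properties using (shift; ∈-resp-↭; ↭-length)
open import Data.List.Relation.Binary.Permutation.Setoid.Properties (≡.setoid ℕ) using (Unique-resp-↭)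
open import Data.List.Relation.Unary.All as All using (All; all?)
open import Data.List.Relation.Unary.Any using (here; there)
open import Data.List.Relation.Unary.Unique.Propositional using (Unique; _∷_)
open import Data.List.Relation.Unary.Unique.Propositional.Properties using (applyUpTo⁺₁)
open import Data.Nat.Coprimality using (prime⇒coprime; coprime-Bézout)
open import Data.Nat.DivMod
  using ( m≡m%n+[m/n]*n; m%n%n≡m%n; m%n<n; m<n⇒m%n≡m; %-distribˡ-+; %-distribˡ-*; %-remove-+ˡ
        ; [m+n]%n≡m%n; [m+kn]%n≡m%n )
open import Data.Nat.Divisibility
  using (_∣_; divides; ∣⇒≤; ∣-refl; n∣m*n; ∣m∣n⇒∣m+n; ∣m⇒∣m*n; m%n≡0⇒n∣m; n∣m⇒m%n≡0)
open import Data.Nat.GCD using (module Bézout)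
open import Data.Nat.ListAction using (sum; product)
open import Data.Nat.ListAction.Properties using (product-↭)
open import Data.Nat.Primality using (Prime; euclidsLemma; prime⇒nonTrivial; ¬prime[0]; ¬prime[1])
open import Data.Nat.Properties
  using ( +-assoc; +-suc; *-comm; *-assoc; *-identityˡ; *-identityʳ; ^-identityʳ; *-distribˡ-∸; *-distribʳ-∸
        ; [m+n]∸[m+o]≡n∸o; m∸n≤m; m∸n≡0⇒m≤n; ≤-antisym; ≤-<-trans; <-trans; <⇒≱; <⇒≢; <⇒≤; ≤∧≢⇒<
        ; m<n⇒m<1+n; n<1+n; ≤-pred; ≤-reflexive; ≡ᵇ⇒≡; *-commutativeSemigroup )
open import Data.Nat.Tactic.RingSolver using (solve-∀)
open import Data.Product using (_×_; _,_; ∃-syntax)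
open import Data.Sum using (_⊎_; inj₁; inj₂)
open import Function using (_∘_; case_of_)
open import Level using (0ℓ)
open import Relation.Binary.Bundles using (Setoid)
import Relation.Binary.Reasoning.Setoid as SetoidReasoning
open import Relation.Nullary using (¬_; does; contradiction)
open import Relation.Nullary.Decidable using (from-yes; dec-false)
open import Relation.Unary using (Pred; Decidable)

∏ : ℕ → (ℕ → ℕ) → ℕ
∏ n f = product (applyUpTo f n)

count : ℕ → (ℕ → Bool) → ℕ
count n b = sum (applyUpTo (λ j → if b j then 1 else 0) n)

∏-cong : ∀ n {f g : ℕ → ℕ} → (∀ i → f i ≡ g i) → ∏ n f ≡ ∏ n g
∏-cong zero    f≗g = refl
∏-cong (suc n) f≗g = cong₂ _*_ (f≗g 0) (∏-cong n (f≗g ∘ suc))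

∏-ones : ∀ n {f : ℕ → ℕ} → (∀ i → f i ≡ 1) → ∏ n f ≡ 1
∏-ones zero    f≗1 = refl
∏-ones (suc n) f≗1 = cong₂ _*_ (f≗1 0) (∏-ones n (f≗1 ∘ suc))

∏-+ : ∀ m n (f : ℕ → ℕ) → ∏ (m + n) f ≡ ∏ m f * ∏ n (λ i → f (m + i))
∏-+ zero    n f = sym (*-identityˡ _)
∏-+ (suc m) n f = trans (cong (f 0 *_) (∏-+ m n (f ∘ suc))) (sym (*-assoc (f 0) _ _))

∏-last : ∀ n (f : ℕ → ℕ) → ∏ (suc n) f ≡ ∏ n f * f n
∏-last zero    f = *-comm (f 0) 1
∏-last (suc n) f = trans (cong (f 0 *_) (∏-last n (f ∘ suc))) (sym (*-assoc (f 0) _ _))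

∏-distrib-* : ∀ n (f g : ℕ → ℕ) → ∏ n (λ i → f i * g i) ≡ ∏ n f * ∏ n g
∏-distrib-* zero    f g = refl
∏-distrib-* (suc n) f g =
  trans (cong (f 0 * g 0 *_) (∏-distrib-* n (f ∘ suc) (g ∘ suc)))
        (interchange *-commutativeSemigroup (f 0) (g 0) _ _)

∏-blocks : ∀ k n (f : ℕ → ℕ) → ∏ (k * n) f ≡ ∏ n (λ i → ∏ k (λ j → f (j * n + i)))
∏-blocks zero    n f = sym (∏-ones n (λ _ → refl))
∏-blocks (suc k) n f = begin
  ∏ (n + k * n) f                                       ≡⟨ ∏-+ n (k * n) f ⟩
  ∏ n f * ∏ (k * n) (λ a → f (n + a))                   ≡⟨ cong (∏ n f *_) (∏-blocks k n _) ⟩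
  ∏ n f * ∏ n (λ i → ∏ k (λ j → f (n + (j * n + i))))  ≡⟨ ∏-distrib-* n f _ ⟨
  ∏ n (λ i → f i * ∏ k (λ j → f (n + (j * n + i))))    ≡⟨ ∏-cong n (λ i → cong (f i *_) (∏-cong k (λ j →
                                                             cong f (sym (+-assoc n (j * n) i))))) ⟩
  ∏ n (λ i → ∏ (suc k) (λ j → f (j * n + i)))          ∎
  where open ≡-Reasoning

∏-suc≡! : ∀ n → ∏ n suc ≡ n !
∏-suc≡! zero    = refl
∏-suc≡! (suc n) = begin
  ∏ (suc n) suc   ≡⟨ ∏-last n suc ⟩
  ∏ n suc * suc n ≡⟨ cong (_* suc n) (∏-suc≡! n) ⟩
  n ! * suc n     ≡⟨ *-comm (n !) (suc n) ⟩
  suc n !         ∎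
  where open ≡-Reasoning

∏-pick : ∀ n (b : ℕ → Bool) x → ∏ n (λ j → if b j then x else 1) ≡ x ^ count n b
∏-pick zero    b x = refl
∏-pick (suc n) b x with b 0
... | true  = cong (x *_) (∏-pick n (b ∘ suc) x)
... | false = trans (*-identityˡ _) (∏-pick n (b ∘ suc) x)

product-filter : ∀ {ℓ} {P : Pred ℕ ℓ} (P? : Decidable P) xs →
  product (filter P? xs) ≡ product (map (λ a → if does (P? a) then a else 1) xs)
product-filter P? []       = refl
product-filter P? (x ∷ xs) with does (P? x)
... | true  = cong (x *_) (product-filter P? xs)
... | false = trans (product-filter P? xs) (sym (*-identityˡ _))

product-filter-oneTo : ∀ {ℓ} {P : Pred ℕ ℓ} (P? : Decidable P) n →
  product (filter P? (oneTo n)) ≡ ∏ n (λ i → if does (P? (suc i)) then suc i else 1)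
product-filter-oneTo P? n = trans (product-filter P? (oneTo n))
  (cong product (trans (cong (map _) (map-upTo suc n)) (map-applyUpTo suc _ n)))

-- A record rather than a synonym for a % n ≡ b % n, so that a and b can be inferred by unification.
infix 4 _≡_mod_
record _≡_mod_ (a b n : ℕ) .{{_ : NonZero n}} : Set where
  constructor mod-≡
  field %-≡ : a % n ≡ b % n

module _ {n : ℕ} .{{_ : NonZero n}} where

  ≡mod-refl : ∀ {a} → a ≡ a mod n
  ≡mod-refl = mod-≡ refl

  ≡mod-sym : ∀ {a b} → a ≡ b mod n → b ≡ a mod n
  ≡mod-sym (mod-≡ a≡b) = mod-≡ (sym a≡b)

  ≡mod-trans : ∀ {a b c} → a ≡ b mod n → b ≡ c mod n → a ≡ c mod n
  ≡mod-trans (mod-≡ a≡b) (mod-≡ b≡c) = mod-≡ (trans a≡b b≡c)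

  mod-setoid : Setoid 0ℓ 0ℓ
  mod-setoid = record
    { Carrier       = ℕ
    ; _≈_           = λ a b → a ≡ b mod n
    ; isEquivalence = record { refl = ≡mod-refl ; sym = ≡mod-sym ; trans = ≡mod-trans }
    }

  %-≡mod : ∀ a → a % n ≡ a mod n
  %-≡mod a = mod-≡ (m%n%n≡m%n a n)

  multiple+-≡mod : ∀ k a → k * n + a ≡ a mod n
  multiple+-≡mod k a = mod-≡ (%-remove-+ˡ a (n∣m*n k))

  +-cong-mod : ∀ {a b c d} → a ≡ b mod n → c ≡ d mod n → a + c ≡ b + d mod n
  +-cong-mod {a} {b} {c} {d} (mod-≡ a≡b) (mod-≡ c≡d) = mod-≡ (begin
    (a + c) % n             ≡⟨ %-distribˡ-+ a c n ⟩
    (a % n + c % n) % n     ≡⟨ cong₂ (λ u v → (u + v) % n) a≡b c≡d ⟩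
    (b % n + d % n) % n     ≡⟨ %-distribˡ-+ b d n ⟨
    (b + d) % n             ∎)
    where open ≡-Reasoning

  *-cong-mod : ∀ {a b c d} → a ≡ b mod n → c ≡ d mod n → a * c ≡ b * d mod n
  *-cong-mod {a} {b} {c} {d} (mod-≡ a≡b) (mod-≡ c≡d) = mod-≡ (begin
    (a * c) % n             ≡⟨ %-distribˡ-* a c n ⟩
    (a % n * (c % n)) % n   ≡⟨ cong₂ (λ u v → (u * v) % n) a≡b c≡d ⟩
    (b % n * (d % n)) % n   ≡⟨ %-distribˡ-* b d n ⟨
    (b * d) % n             ∎)
    where open ≡-Reasoning

  suc-cong-mod : ∀ {a b} → a ≡ b mod n → suc a ≡ suc b mod n
  suc-cong-mod = +-cong-mod {a = 1} ≡mod-refl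

  ∏-cong-mod : ∀ k {f g : ℕ → ℕ} → (∀ {i} → i < k → f i ≡ g i mod n) → ∏ k f ≡ ∏ k g mod n
  ∏-cong-mod zero    f≡g = ≡mod-refl
  ∏-cong-mod (suc k) f≡g = *-cong-mod (f≡g z<s) (∏-cong-mod k (f≡g ∘ s<s))

  if-cong-mod : ∀ c {a b} → a ≡ b mod n → (if c then a else 1) ≡ (if c then b else 1) mod n
  if-cong-mod true  a≡b = a≡b
  if-cong-mod false a≡b = ≡mod-refl

  ≡mod⇒∣∸ : ∀ {a b} → a ≡ b mod n → n ∣ a ∸ b
  ≡mod⇒∣∸ {a} {b} (mod-≡ a≡b) = divides (a / n ∸ b / n) (begin
    a ∸ b                                       ≡⟨ cong₂ _∸_ (m≡m%n+[m/n]*n a n) (m≡m%n+[m/n]*n b n) ⟩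
    (a % n + a / n * n) ∸ (b % n + b / n * n)   ≡⟨ cong (λ r → (a % n + a / n * n) ∸ (r + b / n * n)) a≡b ⟨
    (a % n + a / n * n) ∸ (a % n + b / n * n)   ≡⟨ [m+n]∸[m+o]≡n∸o (a % n) _ _ ⟩
    a / n * n ∸ b / n * n                       ≡⟨ *-distribʳ-∸ n (a / n) (b / n) ⟨
    (a / n ∸ b / n) * n                         ∎)
    where open ≡-Reasoning

  ∣-cong-mod : ∀ {a b} → a ≡ b mod n → n ∣ b → n ∣ a
  ∣-cong-mod {a} {b} (mod-≡ a≡b) n∣b = m%n≡0⇒n∣m a n (trans a≡b (n∣m⇒m%n≡0 b n n∣b))

∣∧<⇒≡0 : ∀ {m n} → n ∣ m → m < n → m ≡ 0
∣∧<⇒≡0 {zero}  _   _   = refl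
∣∧<⇒≡0 {suc m} n∣m m<n = contradiction (∣⇒≤ n∣m) (<⇒≱ m<n)

[1+y]²∸1≡y[2+y] : ∀ y → suc y * suc y ∸ 1 ≡ y * (2 + y)
[1+y]²∸1≡y[2+y] = factor
  where
    factor : ∀ y → y + y * suc y ≡ y * (2 + y)
    factor = solve-∀

∈⇒↭∷ : ∀ {A : Set} {y : A} {ys} → y ∈ ys → ∃[ zs ] ys ↭ y ∷ zs
∈⇒↭∷ y∈ys with ys₁ , ys₂ , refl ← ∈-∃++ y∈ys = ys₁ ++ ys₂ , shift _ ys₁ ys₂

module PrimeModulus {q : ℕ} (p-prime : Prime (suc q)) where

  private
    p : ℕ
    p = suc q

  open SetoidReasoning (mod-setoid {p})

  1≢0-mod : ¬ (1 ≡ 0 mod p)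
  1≢0-mod (mod-≡ 1%p≡0) = contradiction (trans (sym (m<n⇒m%n≡m 1<p)) 1%p≡0) λ ()
    where 1<p = nonTrivial⇒n>1 p {{prime⇒nonTrivial p-prime}}

  *-cancelˡ-mod : ∀ {x y z} → ¬ p ∣ x → y < p → z < p → x * y ≡ x * z mod p → y ≡ z
  *-cancelˡ-mod {x} p∤x y<p z<p xy≡xz =
    ≤-antisym (≤-cancel y<p xy≡xz) (≤-cancel z<p (≡mod-sym xy≡xz))
    where
      ≤-cancel : ∀ {y z} → y < p → x * y ≡ x * z mod p → y ≤ z
      ≤-cancel {y} {z} y<p xy≡xz
        with euclidsLemma x (y ∸ z) p-prime (subst (p ∣_) (sym (*-distribˡ-∸ x y z)) (≡mod⇒∣∸ xy≡xz))
      ... | inj₁ p∣x   = contradiction p∣x p∤x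
      ... | inj₂ p∣y∸z = m∸n≡0⇒m≤n (∣∧<⇒≡0 p∣y∸z (≤-<-trans (m∸n≤m y z) y<p))

  inverse⇒∤ : ∀ {x y} → x * y ≡ 1 mod p → ¬ p ∣ x
  inverse⇒∤ {x} {y} xy≡1 p∣x = 1≢0-mod (begin
    1      ≈⟨ xy≡1 ⟨
    x * y  ≈⟨ mod-≡ (n∣m⇒m%n≡0 (x * y) p (∣m⇒∣m*n y p∣x)) ⟩
    0      ∎)

  record Inverses (x y : ℕ) : Set where
    constructor inverses
    field
      x<p    : x < p
      y<p    : y < p
      xy≡1   : x * y ≡ 1 mod p

  Inverses-sym : ∀ {x y} → Inverses x y → Inverses y x
  Inverses-sym {x} {y} (inverses x<p y<p xy≡1) = inverses y<p x<p (begin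
    y * x  ≡⟨ *-comm y x ⟩
    x * y  ≈⟨ xy≡1 ⟩
    1      ∎)

  Inverses-functional : ∀ {x y z} → Inverses x y → Inverses x z → y ≡ z
  Inverses-functional {x} {y} (inverses _ y<p xy≡1) (inverses _ z<p xz≡1) =
    *-cancelˡ-mod (inverse⇒∤ {x} {y} xy≡1) y<p z<p (≡mod-trans xy≡1 (≡mod-sym xz≡1))

  inverse-exists : ∀ {x} → 0 < x → x < p → ∃[ y ] Inverses x y
  inverse-exists {x@(suc _)} _ x<p with coprime-Bézout (prime⇒coprime p-prime x<p)
  ... | Bézout.-+ a b 1+ap≡bx = b % p , inverses x<p (m%n<n b p) (begin
    x * (b % p)  ≈⟨ *-cong-mod (≡mod-refl {a = x}) (%-≡mod b) ⟩
    x * b        ≡⟨ *-comm x b ⟩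
    b * x        ≡⟨ 1+ap≡bx ⟨
    1 + a * p    ≈⟨ mod-≡ ([m+kn]%n≡m%n 1 a p) ⟩
    1            ∎)
  ... | Bézout.+- a b 1+bx≡ap = q * b % p , inverses x<p (m%n<n (q * b) p) (begin
    x * (q * b % p)       ≈⟨ *-cong-mod (≡mod-refl {a = x}) (%-≡mod (q * b)) ⟩
    x * (q * b)           ≈⟨ mod-≡ ([m+n]%n≡m%n (x * (q * b)) p) ⟨
    x * (q * b) + p       ≡⟨ rearrange x q b ⟩
    q * (1 + b * x) + 1   ≡⟨ cong (λ c → q * c + 1) 1+bx≡ap ⟩
    q * (a * p) + 1       ≡⟨ rearrange′ q a ⟩
    1 + q * a * p         ≈⟨ mod-≡ ([m+kn]%n≡m%n 1 (q * a) p) ⟩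
    1                     ∎)
    where
      rearrange : ∀ x q b → x * (q * b) + suc q ≡ q * (1 + b * x) + 1
      rearrange = solve-∀
      rearrange′ : ∀ q a → q * (a * suc q) + 1 ≡ 1 + q * a * suc q
      rearrange′ = solve-∀

  square≡1⇒ : ∀ {x} → x < p → x * x ≡ 1 mod p → x ≡ 1 ⊎ suc x ≡ p
  square≡1⇒ {zero}  _   0≡1 = contradiction (≡mod-sym 0≡1) 1≢0-mod
  square≡1⇒ {suc y} x<p x²≡1
    with euclidsLemma y (2 + y) p-prime (subst (p ∣_) ([1+y]²∸1≡y[2+y] y) (≡mod⇒∣∸ x²≡1))
  ... | inj₁ p∣y   = inj₁ (cong suc (∣∧<⇒≡0 p∣y (<-trans (n<1+n y) x<p)))
  ... | inj₂ p∣2+y = inj₂ (≤-antisym x<p (∣⇒≤ p∣2+y))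

  PairedByInverses : List ℕ → Set
  PairedByInverses xs = ∀ {x} → x ∈ xs → ∃[ y ] y ∈ xs × y ≢ x × Inverses x y

  product-paired≡1 : ∀ n xs → length xs ≤ n → Unique xs → PairedByInverses xs → product xs ≡ 1 mod p
  product-paired≡1 _       []       _            _      _      = ≡mod-refl
  product-paired≡1 (suc n) (x ∷ ys) (s≤s ∣ys∣≤n) unique paired with paired (here refl)
  ... | y , here refl , y≢x , _ = contradiction refl y≢x
  ... | y , there y∈ys , _ , x⇄y
    with zs , ys↭y∷zs ← ∈⇒↭∷ y∈ys
    with (_ All.∷ x∉zs) ∷ y∉zs ∷ zs-unique ← Unique-resp-↭ (↭⇒↭ₛ (prep x ys↭y∷zs)) unique = begin
    x * product ys        ≡⟨ cong (x *_) (product-↭ ys↭y∷zs) ⟩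
    x * (y * product zs)  ≡⟨ *-assoc x y (product zs) ⟨
    x * y * product zs    ≈⟨ *-cong-mod (Inverses.xy≡1 x⇄y) IH ⟩
    1                     ∎
    where
      ρ : x ∷ ys ↭ x ∷ y ∷ zs
      ρ = prep x ys↭y∷zs

      ∣zs∣≤n : length zs ≤ n
      ∣zs∣≤n = <⇒≤ (subst (_≤ n) (↭-length ys↭y∷zs) ∣ys∣≤n)

      zs-paired : PairedByInverses zs
      zs-paired {z} z∈zs with paired (∈-resp-↭ (↭-sym ρ) (there (there z∈zs)))
      ... | v , v∈xs , v≢z , z⇄v with ∈-resp-↭ ρ v∈xs
      ... | here refl =
        contradiction (Inverses-functional x⇄y (Inverses-sym z⇄v)) (All.lookup y∉zs z∈zs)
      ... | there (here refl) =
        contradiction (Inverses-functional (Inverses-sym x⇄y) (Inverses-sym z⇄v)) (All.lookup x∉zs z∈zs)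
      ... | there (there v∈zs) = v , v∈zs , v≢z , z⇄v

      IH : product zs ≡ 1 mod p
      IH = product-paired≡1 n zs ∣zs∣≤n zs-unique zs-paired

module Wilson {m : ℕ} (p-prime : Prime (3 + m)) where

  private
    p : ℕ
    p = 3 + m

  open PrimeModulus p-prime
  open SetoidReasoning (mod-setoid {p})

  middle : List ℕ
  middle = applyUpTo (λ i → 2 + i) m

  [p∸1]²≡1 : (2 + m) * (2 + m) ≡ 1 mod p
  [p∸1]²≡1 = begin
    (2 + m) * (2 + m)      ≡⟨ expand m ⟩
    1 + (1 + m) * p        ≈⟨ mod-≡ ([m+kn]%n≡m%n 1 (1 + m) p) ⟩
    1                      ∎
    where
      expand : ∀ m → (2 + m) * (2 + m) ≡ 1 + (1 + m) * (3 + m)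
      expand = solve-∀

  ∈-middle⁻ : ∀ {x} → x ∈ middle → 0 < x × x < p × ¬ (x * x ≡ 1 mod p)
  ∈-middle⁻ x∈middle with i , i<m , refl ← ∈-applyUpTo⁻ (λ i → 2 + i) x∈middle =
    z<s , x<p , λ x²≡1 → case square≡1⇒ x<p x²≡1 of λ
      { (inj₁ ())
      ; (inj₂ 3+i≡3+m) → <⇒≢ i<m (cong (_∸ 3) 3+i≡3+m)
      }
    where x<p = s<s (s<s (m<n⇒m<1+n i<m))

  ∈-middle⁺ : ∀ {y} → y < p → ¬ p ∣ y → ¬ (y * y ≡ 1 mod p) → y ∈ middle
  ∈-middle⁺ {0}           _   p∤y _    = contradiction (divides 0 refl) p∤y
  ∈-middle⁺ {1}           _   _   y²≢1 = contradiction ≡mod-refl y²≢1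
  ∈-middle⁺ {suc (suc i)} y<p _   y²≢1 =
    ∈-applyUpTo⁺ (λ i → 2 + i) (≤∧≢⇒< (≤-pred (≤-pred (≤-pred y<p))) i≢m)
    where
      i≢m : i ≢ m
      i≢m refl = y²≢1 [p∸1]²≡1

  middle-unique : Unique middle
  middle-unique = applyUpTo⁺₁ (λ i → 2 + i) m (λ i<j _ → <⇒≢ (s<s (s<s i<j)))

  middle-paired : PairedByInverses middle
  middle-paired {x} x∈middle
    with 0<x , x<p , x²≢1 ← ∈-middle⁻ x∈middle
    with y , x⇄y@(inverses _ y<p xy≡1) ← inverse-exists 0<x x<p =
    y , ∈-middle⁺ y<p (inverse⇒∤ (Inverses.xy≡1 (Inverses-sym x⇄y))) y²≢1 , y≢x , x⇄y
    where
      y≢x : y ≢ x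
      y≢x refl = x²≢1 xy≡1
      y²≢1 : ¬ (y * y ≡ 1 mod p)
      y²≢1 y²≡1 = y≢x (Inverses-functional (inverses y<p y<p y²≡1) (Inverses-sym x⇄y))

  [p∸1]!≡p∸1 : (2 + m) ! ≡ 2 + m mod p
  [p∸1]!≡p∸1 = begin
    (2 + m) * (1 + m) !        ≡⟨ cong ((2 + m) *_) (∏-suc≡! (1 + m)) ⟨
    (2 + m) * ∏ (1 + m) suc    ≡⟨ cong ((2 + m) *_) (*-identityˡ (product middle)) ⟩
    (2 + m) * product middle   ≈⟨ *-cong-mod (≡mod-refl {a = 2 + m}) (product-paired≡1 m middle
                                    (≤-reflexive (length-applyUpTo _ m)) middle-unique middle-paired) ⟩
    (2 + m) * 1                ≡⟨ *-identityʳ (2 + m) ⟩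
    2 + m                      ∎

wilson : ∀ {p} → Prime p → p ∣ suc ((p ∸ 1) !)
wilson {0} p-prime = contradiction p-prime ¬prime[0]
wilson {1} p-prime = contradiction p-prime ¬prime[1]
wilson {2} _       = ∣-refl
wilson {suc (suc (suc m))} p-prime = ∣-cong-mod (suc-cong-mod (Wilson.[p∸1]!≡p∸1 p-prime)) ∣-refl

units : List ℤ
units = + 1 ∷ -[1+ 0 ] ∷ []

0∉units : + 0 ∉ units
0∉units (here ())
0∉units (there (here ()))

chi-4-cong : ∀ {a b} → a ≡ b mod 4 → chi-4 a ≡ chi-4 b
chi-4-cong (mod-≡ a≡b) rewrite a≡b = refl

module _ {q : ℕ} where

  legendre-cong : ∀ {a b} → a ≡ b mod suc q → legendre (suc q) a ≡ legendre (suc q) b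
  legendre-cong {a} {b} (mod-≡ a≡b) rewrite a≡b with b % suc q ≡ᵇ 0
  ... | true  = refl
  ... | false = cong (λ s → if s then + 1 else -[1+ 0 ])
                  (cong (λ r → any (λ x → (x * x) % suc q ≡ᵇ r) (upTo (suc q))) a≡b)

  legendre-multiple : ∀ {a} → suc q ∣ a → legendre (suc q) a ≡ + 0
  legendre-multiple {a} p∣a rewrite n∣m⇒m%n≡0 a (suc q) p∣a = refl

  legendre-unit : ∀ {a} → ¬ suc q ∣ a → legendre (suc q) a ∈ units
  legendre-unit {a} p∤a with a % suc q ≡ᵇ 0 in a%p≡ᵇ0
  ... | true  = contradiction (m%n≡0⇒n∣m a (suc q) (≡ᵇ⇒≡ _ _ (subst T (sym a%p≡ᵇ0) _))) p∤a
  ... | false with isSquareMod (suc q) a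
  ...   | true  = here refl
  ...   | false = there (here refl)

hits : ℕ → ℤ → ℤ → ℕ
hits s L t = count 4 (λ j → does (chi-4 (j * 3 + s) ℤ.* L ≟ t))

-- As j runs over 0..3, j * 3 + s runs over all residues mod 4,
-- and χ₋₄ takes each of the values ±1 at exactly one of them.
exactly-one-hit : ∀ {s L t} → s < 4 → L ∈ units → t ∈ units → hits s L t ≡ 1
exactly-one-hit s<4 L∈units t∈units =
  All.lookup (All.lookup (All.lookup table (∈-upTo⁺ s<4)) L∈units) t∈units
  where
    table : All (λ s → All (λ L → All (λ t → hits s L t ≡ 1) units) units) (upTo 4)
    table = from-yes (all? (λ s → all? (λ L → all? (λ t → hits s L t ℕ.≟ 1) units) units) (upTo 4))

module Fibre {q : ℕ} (p%4≡3 : suc q % 4 ≡ 3) {t : ℤ} (t∈units : t ∈ units) where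

  private
    p : ℕ
    p = suc q

  open SetoidReasoning (mod-setoid {p})

  selected : ℕ → ℕ
  selected a = if does (chi4p p a ≟ t) then a else 1

  block : ℕ → ℕ
  block i = ∏ 4 (λ j → selected (suc (j * p + i)))

  selected-multiple : ∀ {a} → p ∣ a → selected a ≡ 1
  selected-multiple {a} p∣a = trans (cong (λ c → if does (c ≟ t) then a else 1) χ≡0)
                                    (cong (λ b → if b then a else 1) (dec-false (+ 0 ≟ t) 0≢t))
    where
      χ≡0 : chi4p p a ≡ + 0
      χ≡0 = trans (cong (chi-4 a ℤ.*_) (legendre-multiple p∣a)) (ℤ.*-zeroʳ (chi-4 a))
      0≢t : + 0 ≢ t
      0≢t 0≡t = 0∉units (subst (_∈ units) (sym 0≡t) t∈units)

  block-of-multiples : block q ≡ 1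
  block-of-multiples = ∏-ones 4 (λ j → selected-multiple
    (subst (p ∣_) (+-suc (j * p) q) (∣m∣n⇒∣m+n (n∣m*n j) ∣-refl)))

  χ-in-block : ∀ j x → chi4p p (j * p + x) ≡ chi-4 (j * 3 + x % 4) ℤ.* legendre p x
  χ-in-block j x = cong₂ ℤ._*_ (chi-4-cong mod-4) (legendre-cong (multiple+-≡mod j x))
    where
      p≡3 : p ≡ 3 mod 4
      p≡3 = mod-≡ p%4≡3
      mod-4 : j * p + x ≡ j * 3 + x % 4 mod 4
      mod-4 = +-cong-mod (*-cong-mod (≡mod-refl {a = j}) p≡3) (≡mod-sym (%-≡mod x))

  selected-in-block : ∀ j x →
    selected (j * p + x) ≡ (if does (chi-4 (j * 3 + x % 4) ℤ.* legendre p x ≟ t) then x else 1) mod p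
  selected-in-block j x = begin
    selected (j * p + x)
      ≡⟨ cong (λ c → if does (c ≟ t) then j * p + x else 1) (χ-in-block j x) ⟩
    (if does (χ ≟ t) then j * p + x else 1)
      ≈⟨ if-cong-mod (does (χ ≟ t)) (multiple+-≡mod j x) ⟩
    (if does (χ ≟ t) then x else 1)
      ∎
    where χ = chi-4 (j * 3 + x % 4) ℤ.* legendre p x

  block≡suc : ∀ {i} → i < q → block i ≡ suc i mod p
  block≡suc {i} i<q = begin
    block i                             ≡⟨ ∏-cong 4 (λ j → cong selected (sym (+-suc (j * p) i))) ⟩
    ∏ 4 (λ j → selected (j * p + x))    ≈⟨ ∏-cong-mod 4 (λ {j} _ → selected-in-block j x) ⟩
    ∏ 4 (λ j → if hit j then x else 1)  ≡⟨ ∏-pick 4 hit x ⟩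
    x ^ hits (x % 4) (legendre p x) t   ≡⟨ cong (x ^_) one-hit ⟩
    x ^ 1                               ≡⟨ ^-identityʳ x ⟩
    x                                   ∎
    where
      x = suc i
      hit : ℕ → Bool
      hit j = does (chi-4 (j * 3 + x % 4) ℤ.* legendre p x ≟ t)
      p∤x : ¬ p ∣ x
      p∤x p∣x = <⇒≱ (s<s i<q) (∣⇒≤ p∣x)
      one-hit : hits (x % 4) (legendre p x) t ≡ 1
      one-hit = exactly-one-hit (m%n<n x 4) (legendre-unit p∤x) t∈units

  product-fibre≡[p∸1]! : product (filter (λ a → chi4p p a ≟ t) (oneTo (4 * p))) ≡ q ! mod p
  product-fibre≡[p∸1]! = begin
    product (filter (λ a → chi4p p a ≟ t) (oneTo (4 * p)))
                                ≡⟨ product-filter-oneTo (λ a → chi4p p a ≟ t) (4 * p) ⟩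
    ∏ (4 * p) (selected ∘ suc)  ≡⟨ ∏-blocks 4 p (selected ∘ suc) ⟩
    ∏ p block                   ≡⟨ ∏-last q block ⟩
    ∏ q block * block q         ≡⟨ cong (∏ q block *_) block-of-multiples ⟩
    ∏ q block * 1               ≡⟨ *-identityʳ (∏ q block) ⟩
    ∏ q block                   ≈⟨ ∏-cong-mod q block≡suc ⟩
    ∏ q suc                     ≡⟨ ∏-suc≡! q ⟩
    q !                         ∎

lemma4p1 : (p : ℕ) → Prime p → p % 4 ≡ 3 → p > 3 →
    (p ∣ suc (product (filter (λ a → chi4p p a ≟ + 1) (oneTo (4 * p)))))
    × (p ∣ suc (product (filter (λ b → chi4p p b ≟ -[1+ 0 ]) (oneTo (4 * p)))))
lemma4p1 zero    _       ()    _
lemma4p1 (suc q) p-prime p%4≡3 _ = fibre (here refl) , fibre (there (here refl))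
  where
    fibre : ∀ {t} → t ∈ units →
      suc q ∣ suc (product (filter (λ a → chi4p (suc q) a ≟ t) (oneTo (4 * suc q))))
    fibre t∈units = ∣-cong-mod (suc-cong-mod (Fibre.product-fibre≡[p∸1]! p%4≡3 t∈units)) (wilson p-prime)
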